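{- Let $(E,w,d)$ be an ultra triple, let $C\subseteq E$, let $m$ be a nonnegative integer, let $k\in\{1,\ldots,m\}$, let $(c_1,\ldots,c_m)$ be a greedy $m$-permutation of $C$, and let $j\in\{1,\ldots,k\}$. Then $\mathring{\nu}_k(C)\le w(c_j)+\sum_{i\in\{1,\ldots,k\}\setminus\{j\}}d(c_i,c_j)$.
   Context: An ultra triple $(E,w,d)$ consists of a set $E$, a function $w:E\to\mathbb{R}$, and a real-valued function $d$ on ordered pairs of distinct elements of $E$ with $d(a,b)=d(b,a)$ and $d(a,b)\le\max\{d(a,c),d(b,c)\}$ for any three distinct $a,b,c\in E$. For finite $A\subseteq E$, $\operatorname{PER}(A)=\sum_{a\in A}w(a)+\sum d(a,b)$, the second sum over unordered pairs $\{a,b\}\subseteq A$ with $a\ne b$. A greedy $m$-permutation of $C$ is a list $(c_1,\ldots,c_m)$ of $m$ distinct elements of $C$ such that for each $i\in\{1,\ldots,m\}$ and each $x\in C\setminus\{c_1,\ldots,c_{i-1}\}$, $\operatorname{PER}\{c_1,\ldots,c_i\}\ge\operatorname{PER}\{c_1,\ldots,c_{i-1},x\}$. The number $\mathring{\nu}_k(C)$ is defined as $w(c_k)+\sum_{i=1}^{k-1}d(c_i,c_k)$ for any greedy $m$-permutation $(c_1,\ldots,c_m)$ of $C$ (with $m\ge k$); this value does not depend on the choice of the greedy permutation. -}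

module Defs where

open import Data.Nat.Base using (ℕ; zero; suc; _<ᵇ_; _≡ᵇ_)
open import Data.Bool.Base using (Bool; true; false; if_then_else_; not; _∧_)
open import Data.Fin.Base using (Fin; toℕ)
open import Data.List.Base using (List; []; _∷_; _++_; [_]; map; take; allFin; foldr)
open import Data.List.Membership.Propositional using (_∉_)
open import Data.Product.Base using (Σ; ∃; _×_)
open import Data.Sum.Base using (_⊎_; inj₁; inj₂)
open import Relation.Binary.PropositionalEquality using (_≡_; _≢_)
open import Function.Definitions using (Injective)

-- The real numbers, axiomatised as a complete ordered field.
-- (agda-stdlib has no reals; any value of this record is a model of ℝ,
-- i.e. isomorphic to the real numbers.)

record Reals : Set₁ where
  infixl 6 _+_
  infixl 7 _*_
  infix 4 _≤_
  field
    R    : Set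
    0# 1# : R
    _+_ _*_ : R → R → R
    -_   : R → R
    _≤_  : R → R → Set
    +-assoc     : ∀ x y z → (x + y) + z ≡ x + (y + z)
    +-comm      : ∀ x y → x + y ≡ y + x
    +-identityˡ : ∀ x → 0# + x ≡ x
    -‿inverseˡ  : ∀ x → (- x) + x ≡ 0#
    *-assoc     : ∀ x y z → (x * y) * z ≡ x * (y * z)
    *-comm      : ∀ x y → x * y ≡ y * x
    *-identityˡ : ∀ x → 1# * x ≡ x
    distribˡ    : ∀ x y z → x * (y + z) ≡ (x * y) + (x * z)
    0≢1         : 0# ≢ 1#
    *-inverse   : ∀ x → x ≢ 0# → ∃ λ y → x * y ≡ 1#
    ≤-refl      : ∀ x → x ≤ x
    ≤-trans     : ∀ {x y z} → x ≤ y → y ≤ z → x ≤ z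
    ≤-antisym   : ∀ {x y} → x ≤ y → y ≤ x → x ≡ y
    ≤-total     : ∀ x y → x ≤ y ⊎ y ≤ x
    +-monoˡ-≤   : ∀ {x y} z → x ≤ y → x + z ≤ y + z
    *-nonneg    : ∀ {x y} → 0# ≤ x → 0# ≤ y → 0# ≤ x * y
    sup : (S : R → Set) → ∃ S → (∃ λ b → ∀ x → S x → x ≤ b) →
          ∃ λ s → (∀ x → S x → x ≤ s) × (∀ b → (∀ x → S x → x ≤ b) → s ≤ b)

  max : R → R → R
  max x y with ≤-total x y
  ... | inj₁ _ = y
  ... | inj₂ _ = x

  sumR : List R → R
  sumR = foldr _+_ 0#

-- Ultra triples.  d is given as a total function E → E → R, but only its
-- values on pairs of distinct elements are ever constrained or used.

record UltraTriple (ℝ : Reals) : Set₁ where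
  open Reals ℝ
  field
    E     : Set
    w     : E → R
    d     : E → E → R
    d-sym : ∀ a b → a ≢ b → d a b ≡ d b a
    ultra : ∀ a b c → a ≢ b → a ≢ c → b ≢ c → d a b ≤ max (d a c) (d b c)

module _ {ℝ : Reals} (T : UltraTriple ℝ) where
  open Reals ℝ
  open UltraTriple T

  -- PER of the finite set of entries of a duplicate-free list:
  -- sum of weights plus d over all unordered pairs of entries.
  PER : List E → R
  PER []       = 0#
  PER (a ∷ as) = w a + sumR (map (d a) as) + PER as

  -- the list (c_1, ..., c_n) (0-indexed: c 0, ..., c (n-1))
  prefix : ∀ {m} → (Fin m → E) → ℕ → List E
  prefix {m} c n = map c (take n (allFin m))

  sumWhere : ∀ {m} → (Fin m → Bool) → (Fin m → R) → R
  sumWhere {m} P f = sumR (map (λ i → if P i then f i else 0#) (allFin m))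

  -- (c_1,...,c_m) (stored 0-indexed as c : Fin m → E) is a greedy
  -- m-permutation of C
  IsGreedyPerm : (C : E → Set) (m : ℕ) → (Fin m → E) → Set
  IsGreedyPerm C m c =
    Injective _≡_ _≡_ c ×
    (∀ i → C (c i)) ×
    (∀ (i : Fin m) (x : E) → C x → x ∉ prefix c (toℕ i) →
       PER (prefix c (toℕ i) ++ [ x ]) ≤ PER (prefix c (suc (toℕ i))))

  -- ν̊ at (0-indexed) position k, computed from the greedy permutation c:
  -- w(c_k) + Σ_{i<k} d(c_i, c_k)
  nuRing : ∀ {m} → (Fin m → E) → Fin m → R
  nuRing c k = w (c k) + sumWhere (λ i → toℕ i <ᵇ toℕ k) (λ i → d (c i) (c k))

  bound : ∀ {m} → (Fin m → E) → Fin m → Fin m → R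
  bound c k j = w (c j) + sumWhere (λ i → (toℕ i <ᵇ suc (toℕ k)) ∧ not (toℕ i ≡ᵇ toℕ j))
                                   (λ i → d (c i) (c j))

module Submission where

-- Let gain_n(x) = w(x) + Σ_{i<n} d(c_i,x), the increase of PER when x is
-- appended to (c_0,...,c_{n-1}), and rest_n = w(c_j) + Σ_{i<n, i≠j} d(c_i,c_j).
-- Greediness says gain_i(x) ≤ gain_i(c_i) for every x ∈ C outside c_0..c_{i-1}.
-- The key invariant, for every n > j and x ∈ C outside c_0..c_{n-1}, is
--   gain_n(x) ≤ rest_n + d(x,c_j).
-- It holds at n = j+1 by greediness at step j, and it survives appending c_i
-- (i > j) by the ultrametric inequality d(c_i,x) ≤ max{d(c_i,c_j), d(x,c_j)}:
-- in the first case add it to the invariant, in the second use greediness at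
-- step i followed by the invariant for c_i.  For j < k the invariant at n = k
-- applied to x = c_k is the corollary; for j = k both sides coincide.

open import Defs
open import Data.Nat.Base using (ℕ; zero; suc; _≤_; _<_; s≤s; z<s; s<s; _<ᵇ_; _≡ᵇ_)
open import Data.Fin.Base using (Fin; zero; suc; toℕ; fromℕ<)
open import Data.Bool.Base using (Bool; true; false; if_then_else_; not; _∧_)
open import Data.List.Base using (List; []; _∷_; _++_; [_]; map; take; tabulate; allFin)
open import Data.List.Membership.Propositional using (_∈_; _∉_)
open import Data.List.Relation.Unary.Any using (here; there)
open import Data.Product.Base using (∃; _×_; _,_; proj₁; proj₂)
open import Data.Sum.Base using (_⊎_; inj₁; inj₂; [_,_]′)
open import Data.Empty using (⊥-elim)
open import Function.Base using (_∘_; id)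
open import Function.Definitions using (Injective)
open import Relation.Binary.PropositionalEquality
  using (_≡_; _≢_; refl; sym; trans; cong; cong₂; subst; subst₂; isEquivalence; module ≡-Reasoning)
open import Relation.Binary.Structures using (IsPreorder)
open import Algebra.Bundles using (CommutativeMonoid)
import Algebra.Properties.CommutativeSemigroup as CommutativeSemigroupProperties
import Algebra.Solver.CommutativeMonoid as CommutativeMonoidSolver
import Relation.Binary.Reasoning.Base.Double as PreorderReasoning
import Data.Nat.Properties as ℕₚ
import Data.Fin.Properties as Finₚ
import Data.List.Properties as Listₚ

module OrderedFieldFacts (ℝ : Reals) where
  open Reals ℝ renaming (_≤_ to _≤ᵣ_)

  +-identityʳ : ∀ x → x + 0# ≡ x
  +-identityʳ x = trans (+-comm x 0#) (+-identityˡ x)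

  +-monoʳ-≤ : ∀ {x y} z → x ≤ᵣ y → z + x ≤ᵣ z + y
  +-monoʳ-≤ {x} {y} z x≤y = subst₂ _≤ᵣ_ (+-comm x z) (+-comm y z) (+-monoˡ-≤ z x≤y)

  +-mono-≤ : ∀ {a b x y} → a ≤ᵣ b → x ≤ᵣ y → a + x ≤ᵣ b + y
  +-mono-≤ {b = b} {x = x} a≤b x≤y = ≤-trans (+-monoˡ-≤ x a≤b) (+-monoʳ-≤ b x≤y)

  +-cancelˡ-≤ : ∀ {x y} z → z + x ≤ᵣ z + y → x ≤ᵣ y
  +-cancelˡ-≤ z z+x≤z+y = subst₂ _≤ᵣ_ (undo _) (undo _) (+-monoʳ-≤ (- z) z+x≤z+y)
    where
    undo : ∀ a → (- z) + (z + a) ≡ a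
    undo a = trans (sym (+-assoc (- z) z a))
                   (trans (cong (_+ a) (-‿inverseˡ z)) (+-identityˡ a))

  ≤-max-cases : ∀ {z} a b → z ≤ᵣ max a b → z ≤ᵣ a ⊎ z ≤ᵣ b
  ≤-max-cases a b z≤max with ≤-total a b
  ... | inj₁ _ = inj₂ z≤max
  ... | inj₂ _ = inj₁ z≤max

  ≤-isPreorder : IsPreorder _≡_ _≤ᵣ_
  ≤-isPreorder = record
    { isEquivalence = isEquivalence
    ; reflexive     = λ { refl → ≤-refl _ }
    ; trans         = ≤-trans
    }

  module ≤ᵣ-Reasoning = PreorderReasoning ≤-isPreorder

  +-commutativeMonoid : CommutativeMonoid _ _
  +-commutativeMonoid = record
    { Carrier = R ; _≈_ = _≡_ ; _∙_ = _+_ ; ε = 0#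
    ; isCommutativeMonoid = record
      { isMonoid = record
        { isSemigroup = record
          { isMagma = record { isEquivalence = isEquivalence ; ∙-cong = cong₂ _+_ }
          ; assoc = +-assoc }
        ; identity = +-identityˡ , +-identityʳ }
      ; comm = +-comm } }

  open CommutativeSemigroupProperties
    (CommutativeMonoid.commutativeSemigroup +-commutativeMonoid)
    using (xy∙z≈xz∙y) public

  sumR-++ : ∀ xs ys → sumR (xs ++ ys) ≡ sumR xs + sumR ys
  sumR-++ []       ys = sym (+-identityˡ _)
  sumR-++ (x ∷ xs) ys = trans (cong (x +_) (sumR-++ xs ys)) (sym (+-assoc x _ _))

<ᵇ-suc : ∀ a n → a ≢ n → (a <ᵇ suc n) ≡ (a <ᵇ n)
<ᵇ-suc zero    zero    a≢n = ⊥-elim (a≢n refl)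
<ᵇ-suc zero    (suc n) a≢n = refl
<ᵇ-suc (suc a) zero    a≢n = refl
<ᵇ-suc (suc a) (suc n) a≢n = <ᵇ-suc a n (a≢n ∘ cong suc)

n<ᵇsuc[n] : ∀ n → (n <ᵇ suc n) ≡ true
n<ᵇsuc[n] zero    = refl
n<ᵇsuc[n] (suc n) = n<ᵇsuc[n] n

n<ᵇn : ∀ n → (n <ᵇ n) ≡ false
n<ᵇn zero    = refl
n<ᵇn (suc n) = n<ᵇn n

≢⇒≡ᵇ-false : ∀ a n → a ≢ n → (a ≡ᵇ n) ≡ false
≢⇒≡ᵇ-false zero    zero    a≢n = ⊥-elim (a≢n refl)
≢⇒≡ᵇ-false zero    (suc n) a≢n = refl
≢⇒≡ᵇ-false (suc a) zero    a≢n = refl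
≢⇒≡ᵇ-false (suc a) (suc n) a≢n = ≢⇒≡ᵇ-false a n (a≢n ∘ cong suc)

<ᵇ-suc-except : ∀ a n → ((a <ᵇ suc n) ∧ not (a ≡ᵇ n)) ≡ (a <ᵇ n)
<ᵇ-suc-except zero    zero    = refl
<ᵇ-suc-except zero    (suc n) = refl
<ᵇ-suc-except (suc a) zero    = refl
<ᵇ-suc-except (suc a) (suc n) = <ᵇ-suc-except a n

∈-take-tabulate⁻ : ∀ {A : Set} {m} n (g : Fin m → A) {x} →
                   x ∈ take n (tabulate g) → ∃ λ i → toℕ i < n × x ≡ g i
∈-take-tabulate⁻ {m = suc m} (suc n) g (here x≡g0) = zero , z<s , x≡g0
∈-take-tabulate⁻ {m = suc m} (suc n) g (there x∈) with ∈-take-tabulate⁻ n (g ∘ suc) x∈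
... | i , i<n , x≡gi = suc i , s<s i<n , x≡gi

map-take-tabulate : ∀ {A B : Set} {m} n (g : Fin m → A) (f : A → B) →
                    map f (take n (tabulate g)) ≡ take n (tabulate (f ∘ g))
map-take-tabulate n g f = trans (sym (Listₚ.take-map n (tabulate g)))
                                (cong (take n) (Listₚ.map-tabulate g f))

module FinSums {ℝ : Reals} (T : UltraTriple ℝ) where
  open Reals ℝ
  open OrderedFieldFacts ℝ

  ΣFin : ∀ {m} → (Fin m → R) → R
  ΣFin g = sumR (tabulate g)

  restrict : ∀ {m} → (Fin m → Bool) → (Fin m → R) → Fin m → R
  restrict P f i = if P i then f i else 0#

  ΣFin-zeros : ∀ m → ΣFin {m} (λ _ → 0#) ≡ 0#
  ΣFin-zeros zero    = refl
  ΣFin-zeros (suc m) = trans (+-identityˡ _) (ΣFin-zeros m)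

  ΣFin-cong : ∀ {m} {g h : Fin m → R} → (∀ i → g i ≡ h i) → ΣFin g ≡ ΣFin h
  ΣFin-cong g≗h = cong sumR (Listₚ.tabulate-cong g≗h)

  ΣFin-insert : ∀ {m} (g h : Fin m → R) (i₀ : Fin m) →
                (∀ i → i ≢ i₀ → h i ≡ g i) → g i₀ ≡ 0# → ΣFin h ≡ ΣFin g + h i₀
  ΣFin-insert {suc m} g h zero h≗g g0≡0 = begin
    h zero + ΣFin (h ∘ suc)   ≡⟨ cong (h zero +_) (ΣFin-cong (λ i → h≗g (suc i) λ ())) ⟩
    h zero + ΣFin (g ∘ suc)   ≡⟨ +-comm (h zero) _ ⟩
    ΣFin (g ∘ suc) + h zero   ≡⟨ cong (_+ h zero) (sym g0-vanishes) ⟩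
    (g zero + ΣFin (g ∘ suc)) + h zero ∎
    where
    open ≡-Reasoning
    g0-vanishes : g zero + ΣFin (g ∘ suc) ≡ ΣFin (g ∘ suc)
    g0-vanishes = trans (cong (_+ ΣFin (g ∘ suc)) g0≡0) (+-identityˡ (ΣFin (g ∘ suc)))
  ΣFin-insert {suc m} g h (suc i₀) h≗g gi₀≡0 = begin
    h zero + ΣFin (h ∘ suc)                ≡⟨ cong (h zero +_) (ΣFin-insert (g ∘ suc) (h ∘ suc) i₀ h≗g′ gi₀≡0) ⟩
    h zero + (ΣFin (g ∘ suc) + h (suc i₀)) ≡⟨ sym (+-assoc _ _ _) ⟩
    (h zero + ΣFin (g ∘ suc)) + h (suc i₀) ≡⟨ cong (λ v → (v + _) + _) (h≗g zero λ ()) ⟩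
    (g zero + ΣFin (g ∘ suc)) + h (suc i₀) ∎
    where
    open ≡-Reasoning
    h≗g′ : ∀ i → i ≢ i₀ → h (suc i) ≡ g (suc i)
    h≗g′ i i≢i₀ = h≗g (suc i) (i≢i₀ ∘ Finₚ.suc-injective)

  ΣFin-take : ∀ {m} n (g : Fin m → R) →
              sumR (take n (tabulate g)) ≡ ΣFin (restrict (λ i → toℕ i <ᵇ n) g)
  ΣFin-take {zero}  zero    g = refl
  ΣFin-take {zero}  (suc n) g = refl
  ΣFin-take {suc m} zero    g = sym (ΣFin-zeros (suc m))
  ΣFin-take {suc m} (suc n) g = cong (g zero +_) (ΣFin-take n (g ∘ suc))

  sumWhere-ΣFin : ∀ {m} (P : Fin m → Bool) (f : Fin m → R) →
                  sumWhere T P f ≡ ΣFin (restrict P f)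
  sumWhere-ΣFin {m} P f = cong sumR (Listₚ.map-tabulate {n = m} id (restrict P f))

  sumWhere-cong : ∀ {m} {P Q : Fin m → Bool} (f : Fin m → R) →
                  (∀ i → P i ≡ Q i) → sumWhere T P f ≡ sumWhere T Q f
  sumWhere-cong f P≗Q = cong sumR (Listₚ.map-cong (λ i → cong (λ b → if b then f i else 0#) (P≗Q i)) (allFin _))

  sumWhere-insert : ∀ {m} (P Q : Fin m → Bool) (f : Fin m → R) (i₀ : Fin m) →
                    (∀ i → i ≢ i₀ → P i ≡ Q i) → P i₀ ≡ false → Q i₀ ≡ true →
                    sumWhere T Q f ≡ sumWhere T P f + f i₀
  sumWhere-insert P Q f i₀ P≗Q Pi₀ Qi₀ = begin
    sumWhere T Q f                             ≡⟨ sumWhere-ΣFin Q f ⟩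
    ΣFin (restrict Q f)                        ≡⟨ ΣFin-insert (restrict P f) (restrict Q f) i₀ agree vanish ⟩
    ΣFin (restrict P f) + restrict Q f i₀      ≡⟨ cong₂ _+_ (sym (sumWhere-ΣFin P f)) (cong (λ b → if b then f i₀ else 0#) Qi₀) ⟩
    sumWhere T P f + f i₀                      ∎
    where
    open ≡-Reasoning
    agree : ∀ i → i ≢ i₀ → restrict Q f i ≡ restrict P f i
    agree i i≢i₀ = cong (λ b → if b then f i else 0#) (sym (P≗Q i i≢i₀))
    vanish : restrict P f i₀ ≡ 0#
    vanish = cong (λ b → if b then f i₀ else 0#) Pi₀

module PerimeterFacts {ℝ : Reals} (T : UltraTriple ℝ) where
  open Reals ℝ
  open UltraTriple T
  open OrderedFieldFacts ℝ

  appendGain : List E → E → R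
  appendGain L x = w x + sumR (map (λ a → d a x) L)

  PER-snoc : ∀ L x → PER T (L ++ [ x ]) ≡ PER T L + appendGain L x
  PER-snoc [] x = trans (+-identityʳ _) (sym (+-identityˡ _))
  PER-snoc (a ∷ L) x = begin
    w a + sumR (map (d a) (L ++ [ x ])) + PER T (L ++ [ x ])
      ≡⟨ cong₂ (λ s p → w a + s + p)
               (trans (cong sumR (Listₚ.map-++ (d a) L [ x ])) (sumR-++ (map (d a) L) [ d a x ]))
               (PER-snoc L x) ⟩
    w a + (sumR (map (d a) L) + (d a x + 0#)) + (PER T L + (w x + sumR (map (λ b → d b x) L)))
      ≡⟨ rearrange (w a) (sumR (map (d a) L)) (d a x) (PER T L) (w x) (sumR (map (λ b → d b x) L)) ⟩
    (w a + sumR (map (d a) L) + PER T L) + (w x + (d a x + sumR (map (λ b → d b x) L))) ∎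
    where
    open ≡-Reasoning
    open CommutativeMonoidSolver +-commutativeMonoid using (solve; _⊜_; _⊕_) renaming (id to ε)
    rearrange : ∀ p q r s t u → p + (q + (r + 0#)) + (s + (t + u)) ≡ (p + q + s) + (t + (r + u))
    rearrange = solve 6 (λ p q r s t u → ((p ⊕ (q ⊕ (r ⊕ ε))) ⊕ (s ⊕ (t ⊕ u))) ⊜ (((p ⊕ q) ⊕ s) ⊕ (t ⊕ (r ⊕ u)))) refl

module GreedyPermutation {ℝ : Reals} (T : UltraTriple ℝ) (C : UltraTriple.E T → Set)
                         {m : ℕ} (c : Fin m → UltraTriple.E T) (greedy : IsGreedyPerm T C m c)
                         where
  open Reals ℝ renaming (_≤_ to _≤ᵣ_)
  open UltraTriple T
  open OrderedFieldFacts ℝ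
  open FinSums T
  open PerimeterFacts T

  c-injective : Injective _≡_ _≡_ c
  c-injective = proj₁ greedy

  c∈C : ∀ i → C (c i)
  c∈C = proj₁ (proj₂ greedy)

  greedy-PER : ∀ (i : Fin m) x → C x → x ∉ prefix T c (toℕ i) →
               PER T (prefix T c (toℕ i) ++ [ x ]) ≤ᵣ PER T (prefix T c (suc (toℕ i)))
  greedy-PER = proj₂ (proj₂ greedy)

  Fresh : ℕ → E → Set
  Fresh n x = ∀ i → toℕ i < n → c i ≢ x

  Fresh-pred : ∀ {n x} → Fresh (suc n) x → Fresh n x
  Fresh-pred fresh i i<n = fresh i (ℕₚ.m<n⇒m<1+n i<n)

  c-fresh : ∀ i → Fresh (toℕ i) (c i)
  c-fresh i i′ i′<i ci′≡ci = ℕₚ.<-irrefl (cong toℕ (c-injective ci′≡ci)) i′<i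

  prefix-tabulate : ∀ n → prefix T c n ≡ take n (tabulate c)
  prefix-tabulate n = map-take-tabulate n id c

  Fresh⇒∉ : ∀ {n x} → Fresh n x → x ∉ prefix T c n
  Fresh⇒∉ {n} fresh x∈ with ∈-take-tabulate⁻ n c (subst (_ ∈_) (prefix-tabulate n) x∈)
  ... | i , i<n , x≡ci = fresh i i<n (sym x≡ci)

  prefix-snoc : ∀ i → prefix T c (suc (toℕ i)) ≡ prefix T c (toℕ i) ++ [ c i ]
  prefix-snoc i = begin
    prefix T c (suc (toℕ i))            ≡⟨ prefix-tabulate (suc (toℕ i)) ⟩
    take (suc (toℕ i)) (tabulate c)     ≡⟨ Listₚ.take-suc-tabulate c i ⟩
    take (toℕ i) (tabulate c) ++ [ c i ] ≡⟨ cong (_++ [ c i ]) (sym (prefix-tabulate (toℕ i))) ⟩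
    prefix T c (toℕ i) ++ [ c i ]       ∎
    where open ≡-Reasoning

  below : ℕ → Fin m → Bool
  below n i = toℕ i <ᵇ n

  -- the increase of PER when x is appended to (c_0, ..., c_{n-1});
  -- note that nuRing T c k is gain (toℕ k) (c k) by definition
  gain : ℕ → E → R
  gain n x = w x + sumWhere T (below n) (λ i → d (c i) x)

  PER-prefix-snoc : ∀ n x → PER T (prefix T c n ++ [ x ]) ≡ PER T (prefix T c n) + gain n x
  PER-prefix-snoc n x = trans (PER-snoc (prefix T c n) x) (cong (λ s → PER T (prefix T c n) + (w x + s)) (begin
    sumR (map (λ a → d a x) (prefix T c n))          ≡⟨ cong (sumR ∘ map (λ a → d a x)) (prefix-tabulate n) ⟩
    sumR (map (λ a → d a x) (take n (tabulate c)))   ≡⟨ cong sumR (map-take-tabulate n c (λ a → d a x)) ⟩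
    sumR (take n (tabulate (λ i → d (c i) x)))       ≡⟨ ΣFin-take n (λ i → d (c i) x) ⟩
    ΣFin (restrict (below n) (λ i → d (c i) x))      ≡⟨ sym (sumWhere-ΣFin (below n) (λ i → d (c i) x)) ⟩
    sumWhere T (below n) (λ i → d (c i) x)           ∎))
    where open ≡-Reasoning

  greedy-gain : ∀ i x → C x → Fresh (toℕ i) x → gain (toℕ i) x ≤ᵣ gain (toℕ i) (c i)
  greedy-gain i x x∈C fresh = +-cancelˡ-≤ (PER T (prefix T c (toℕ i)))
    (subst₂ _≤ᵣ_ (PER-prefix-snoc (toℕ i) x)
                 (trans (cong (PER T) (prefix-snoc i)) (PER-prefix-snoc (toℕ i) (c i)))
                 (greedy-PER i x x∈C (Fresh⇒∉ fresh)))

  gain-step : ∀ i x → gain (suc (toℕ i)) x ≡ gain (toℕ i) x + d (c i) x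
  gain-step i x = trans (cong (w x +_) sums) (sym (+-assoc _ _ _))
    where
    sums : sumWhere T (below (suc (toℕ i))) (λ i′ → d (c i′) x)
           ≡ sumWhere T (below (toℕ i)) (λ i′ → d (c i′) x) + d (c i) x
    sums = sumWhere-insert (below (toℕ i)) (below (suc (toℕ i))) (λ i′ → d (c i′) x) i
             (λ i′ i′≢i → sym (<ᵇ-suc (toℕ i′) (toℕ i) (i′≢i ∘ Finₚ.toℕ-injective)))
             (n<ᵇn (toℕ i)) (n<ᵇsuc[n] (toℕ i))

  module Pivot (j : Fin m) where

    -- w(c_j) + Σ_{i<n, i≠j} d(c_i,c_j); bound T c k j is rest (suc (toℕ k)) by definition
    rest : ℕ → R
    rest n = w (c j) + sumWhere T (λ i → below n i ∧ not (toℕ i ≡ᵇ toℕ j)) (λ i → d (c i) (c j))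

    -- up to and including j, excluding index j changes nothing
    rest-start : rest (suc (toℕ j)) ≡ gain (toℕ j) (c j)
    rest-start = cong (w (c j) +_) (sumWhere-cong (λ i → d (c i) (c j)) (λ i → <ᵇ-suc-except (toℕ i) (toℕ j)))

    rest-step : ∀ i → i ≢ j → rest (suc (toℕ i)) ≡ rest (toℕ i) + d (c i) (c j)
    rest-step i i≢j = trans (cong (w (c j) +_) sums) (sym (+-assoc _ _ _))
      where
      skip : Fin m → Bool
      skip i′ = not (toℕ i′ ≡ᵇ toℕ j)
      sums : sumWhere T (λ i′ → below (suc (toℕ i)) i′ ∧ skip i′) (λ i′ → d (c i′) (c j))
             ≡ sumWhere T (λ i′ → below (toℕ i) i′ ∧ skip i′) (λ i′ → d (c i′) (c j)) + d (c i) (c j)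
      sums = sumWhere-insert (λ i′ → below (toℕ i) i′ ∧ skip i′) (λ i′ → below (suc (toℕ i)) i′ ∧ skip i′)
               (λ i′ → d (c i′) (c j)) i
               (λ i′ i′≢i → cong (_∧ skip i′) (sym (<ᵇ-suc (toℕ i′) (toℕ i) (i′≢i ∘ Finₚ.toℕ-injective))))
               (cong (_∧ skip i) (n<ᵇn (toℕ i)))
               (cong₂ (λ a b → a ∧ not b) (n<ᵇsuc[n] (toℕ i)) (≢⇒≡ᵇ-false (toℕ i) (toℕ j) (i≢j ∘ Finₚ.toℕ-injective)))

    Dominated : ℕ → Set
    Dominated n = ∀ x → C x → Fresh n x → gain n x ≤ᵣ rest n + d x (c j)

    -- the invariant starts at n = j+1, by greediness at step j
    dominated-start : Dominated (suc (toℕ j))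
    dominated-start x x∈C fresh = begin
      gain (suc (toℕ j)) x           ≡⟨ gain-step j x ⟩
      gain (toℕ j) x + d (c j) x     ≲⟨ +-monoˡ-≤ (d (c j) x) (greedy-gain j x x∈C (Fresh-pred fresh)) ⟩
      gain (toℕ j) (c j) + d (c j) x ≡⟨ cong₂ _+_ (sym rest-start) (d-sym (c j) x (fresh j (ℕₚ.n<1+n _))) ⟩
      rest (suc (toℕ j)) + d x (c j) ∎
      where open ≤ᵣ-Reasoning

    -- adding c_i keeps the invariant, by the ultrametric inequality for c_i, x, c_j
    dominated-step : ∀ i → toℕ j < toℕ i → Dominated (toℕ i) → Dominated (suc (toℕ i))
    dominated-step i j<i invariant x x∈C fresh =
      [ via-c-j , via-x ]′ (≤-max-cases (d (c i) (c j)) (d x (c j)) (ultra (c i) x (c j) ci≢x ci≢cj x≢cj))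
      where
      open ≤ᵣ-Reasoning
      ci≢x : c i ≢ x
      ci≢x = fresh i (ℕₚ.n<1+n _)
      ci≢cj : c i ≢ c j
      ci≢cj ci≡cj = c-fresh i j j<i (sym ci≡cj)
      x≢cj : x ≢ c j
      x≢cj x≡cj = fresh j (ℕₚ.m<n⇒m<1+n j<i) (sym x≡cj)
      rest-step′ : rest (toℕ i) + d (c i) (c j) ≡ rest (suc (toℕ i))
      rest-step′ = sym (rest-step i (λ i≡j → ci≢cj (cong c i≡j)))

      -- d(c_i,x) ≤ d(c_i,c_j): add this to the invariant for x
      via-c-j : d (c i) x ≤ᵣ d (c i) (c j) → gain (suc (toℕ i)) x ≤ᵣ rest (suc (toℕ i)) + d x (c j)
      via-c-j near-cj = begin
        gain (suc (toℕ i)) x                       ≡⟨ gain-step i x ⟩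
        gain (toℕ i) x + d (c i) x                 ≲⟨ +-mono-≤ (invariant x x∈C (Fresh-pred fresh)) near-cj ⟩
        (rest (toℕ i) + d x (c j)) + d (c i) (c j) ≡⟨ xy∙z≈xz∙y _ _ _ ⟩
        (rest (toℕ i) + d (c i) (c j)) + d x (c j) ≡⟨ cong (_+ d x (c j)) rest-step′ ⟩
        rest (suc (toℕ i)) + d x (c j)             ∎

      -- d(c_i,x) ≤ d(x,c_j): greediness at step i, then the invariant for c_i
      via-x : d (c i) x ≤ᵣ d x (c j) → gain (suc (toℕ i)) x ≤ᵣ rest (suc (toℕ i)) + d x (c j)
      via-x near-x = begin
        gain (suc (toℕ i)) x                       ≡⟨ gain-step i x ⟩
        gain (toℕ i) x + d (c i) x                 ≲⟨ +-mono-≤ (greedy-gain i x x∈C (Fresh-pred fresh)) near-x ⟩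
        gain (toℕ i) (c i) + d x (c j)             ≲⟨ +-monoˡ-≤ (d x (c j)) (invariant (c i) (c∈C i) (c-fresh i)) ⟩
        (rest (toℕ i) + d (c i) (c j)) + d x (c j) ≡⟨ cong (_+ d x (c j)) rest-step′ ⟩
        rest (suc (toℕ i)) + d x (c j)             ∎

    dominated : ∀ n → n ≤ m → toℕ j < n → Dominated n
    dominated (suc n) n<m (s≤s j≤n) with ℕₚ.m≤n⇒m<n∨m≡n j≤n
    ... | inj₂ refl = dominated-start
    ... | inj₁ j<n  = step n<m j<n (dominated n (ℕₚ.<⇒≤ n<m) j<n)
      where
      step : ∀ {n} (n<m : n < m) → toℕ j < n → Dominated n → Dominated (suc n)
      step n<m with fromℕ< n<m | Finₚ.toℕ-fromℕ< n<m
      ... | i | refl = dominated-step i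

    -- the corollary for k = j: both sides are w(c_j) + Σ_{i<j} d(c_i,c_j)
    nuRing≤bound-diagonal : nuRing T c j ≤ᵣ bound T c j j
    nuRing≤bound-diagonal = subst (nuRing T c j ≤ᵣ_) (sym rest-start) (≤-refl _)

    -- the corollary for j < k: the invariant at n = k, applied to x = c_k
    nuRing≤bound-later : ∀ k → toℕ j < toℕ k → nuRing T c k ≤ᵣ bound T c k j
    nuRing≤bound-later k j<k = begin
      gain (toℕ k) (c k)              ≲⟨ dominated (toℕ k) (ℕₚ.<⇒≤ (Finₚ.toℕ<n k)) j<k (c k) (c∈C k) (c-fresh k) ⟩
      rest (toℕ k) + d (c k) (c j)    ≡⟨ sym (rest-step k (λ k≡j → ℕₚ.<-irrefl (cong toℕ (sym k≡j)) j<k)) ⟩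
      rest (suc (toℕ k))              ∎
      where open ≤ᵣ-Reasoning

corollary5p2 : (ℝ : Reals) (T : UltraTriple ℝ) (C : UltraTriple.E T → Set)
               (m : ℕ) (c : Fin m → UltraTriple.E T) → IsGreedyPerm T C m c →
               (k j : Fin m) → toℕ j ≤ toℕ k →
               Reals._≤_ ℝ (nuRing T c k) (bound T c k j)
corollary5p2 ℝ T C m c greedy k j j≤k with ℕₚ.m≤n⇒m<n∨m≡n j≤k
... | inj₁ j<k = nuRing≤bound-later k j<k
  where open GreedyPermutation.Pivot T C c greedy j
... | inj₂ j≡k rewrite Finₚ.toℕ-injective j≡k = nuRing≤bound-diagonal
  where open GreedyPermutation.Pivot T C c greedy k
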